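{- Let $(T_{\alpha,j,k})$, $\alpha\in\{1,2\}$, $j,k\in\mathbb Z$, $\alpha+j+k$ even, be the solution of the $A_2$ $T$-system $$T_{1,j,k+1}T_{1,j,k-1}=T_{1,j+1,k}T_{1,j-1,k}+T_{2,j,k},\qquad T_{2,j,k+1}T_{2,j,k-1}=T_{2,j+1,k}T_{2,j-1,k}+T_{1,j,k},$$ expressed in terms of the initial data $\{T_{\alpha,j,k}: \alpha\in\{1,2\},\ k\in\{0,1\},\ j\in\mathbb Z,\ \alpha+j+k \text{ even}\}$. For integers $t$ define the $3\times 3$ matrices $$\mathfrak A_t=A(T_{1,t,0},T_{1,t+1,1},T_{2,t,1},T_{2,t+1,0})\ (t\text{ odd}),\qquad \mathfrak B_t=B(T_{1,t,1},T_{1,t+1,0},T_{2,t,0},T_{2,t+1,1})\ (t\text{ even}).$$ Then for all $j\in\mathbb Z$ and integers $k\ge 1$ with $1+j+k$ even, $$T_{1,j,k}=T_{1,j+k-1,1}\left(\prod_{i=0}^{k-2}\mathfrak B_{j-k+2i+1}\,\mathfrak A_{j-k+2i+2}\right)_{1,1},$$ where the product is ordered from left to right with increasing $i$ (and is the identity matrix when $k=1$).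
   Context: For nonzero reals define $$A(a,b,u,v)=\begin{pmatrix}1&0&0\\ \frac ub&\frac{au}{bv}&\frac av\\ 0&0&1\end{pmatrix},\qquad B(a,b,u,v)=\begin{pmatrix}\frac ab&\frac1b&0\\ 0&1&0\\ 0&\frac1v&\frac uv\end{pmatrix}.$$ $(M)_{1,1}$ denotes the top-left entry of a matrix $M$. -}

module Defs where

open import Level using (Level; _⊔_) renaming (suc to lsuc)
open import Algebra.Bundles using (CommutativeRing)
open import Data.Fin using (Fin; zero; suc)
open import Data.Nat using (ℕ) renaming (zero to nzero; suc to nsuc)
open import Data.Integer using (ℤ; +_) renaming (_+_ to _+ℤ_; _-_ to _-ℤ_)
open import Data.Product using (Σ)
open import Relation.Binary.PropositionalEquality using (_≡_)
open import Relation.Nullary using (¬_)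

record Field (c ℓ : Level) : Set (lsuc (c ⊔ ℓ)) where
  field
    commutativeRing : CommutativeRing c ℓ
  open CommutativeRing commutativeRing public
  field
    _⁻¹        : Carrier → Carrier
    ⁻¹-inverse : ∀ x → ¬ (x ≈ 0#) → x * (x ⁻¹) ≈ 1#
    0≉1        : ¬ (0# ≈ 1#)

Even : ℤ → Set
Even z = Σ ℤ (λ m → z ≡ m +ℤ m)

lab : Fin 2 → ℤ
lab zero    = + 1
lab (suc _) = + 2

module FieldDefs {c ℓ : Level} (F : Field c ℓ) where
  open Field F using (Carrier; _≈_; _+_; _*_; 0#; 1#; _⁻¹)

  _÷_ : Carrier → Carrier → Carrier
  x ÷ y = x * (y ⁻¹)

  -- 3×3 matrices, indices 0,1,2 (entry (1,1) of the paper is (zero,zero)).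
  Mat3 : Set c
  Mat3 = Fin 3 → Fin 3 → Carrier

  I3 : Mat3
  I3 zero          zero          = 1#
  I3 (suc zero)    (suc zero)    = 1#
  I3 (suc (suc _)) (suc (suc _)) = 1#
  I3 _             _             = 0#

  _⊗_ : Mat3 → Mat3 → Mat3
  (M ⊗ N) i k = M i zero * N zero k + (M i (suc zero) * N (suc zero) k + M i (suc (suc zero)) * N (suc (suc zero)) k)

  matA : Carrier → Carrier → Carrier → Carrier → Mat3
  matA a b u v zero          zero          = 1#
  matA a b u v zero          (suc _)       = 0#
  matA a b u v (suc zero)    zero          = u ÷ b
  matA a b u v (suc zero)    (suc zero)    = (a * u) ÷ (b * v)
  matA a b u v (suc zero)    (suc (suc _)) = a ÷ v
  matA a b u v (suc (suc _)) zero          = 0#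
  matA a b u v (suc (suc _)) (suc zero)    = 0#
  matA a b u v (suc (suc _)) (suc (suc _)) = 1#

  matB : Carrier → Carrier → Carrier → Carrier → Mat3
  matB a b u v zero          zero          = a ÷ b
  matB a b u v zero          (suc zero)    = 1# ÷ b
  matB a b u v zero          (suc (suc _)) = 0#
  matB a b u v (suc zero)    zero          = 0#
  matB a b u v (suc zero)    (suc zero)    = 1#
  matB a b u v (suc zero)    (suc (suc _)) = 0#
  matB a b u v (suc (suc _)) zero          = 0#
  matB a b u v (suc (suc _)) (suc zero)    = 1# ÷ v
  matB a b u v (suc (suc _)) (suc (suc _)) = u ÷ v

  α₁ α₂ : Fin 2
  α₁ = zero
  α₂ = suc zero

  -- T : Fin 2 → ℤ → ℤ → Carrier ; T α j k is meaningful only when lab α +ℤ j +ℤ k is even.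
  -- Solution of the A₂ T-system with all (relevant) values nonzero.
  record IsA2TSystemSolution (T : Fin 2 → ℤ → ℤ → Carrier) : Set (c ⊔ ℓ) where
    field
      nonzero : ∀ α j k → Even (lab α +ℤ j +ℤ k) → ¬ (T α j k ≈ 0#)
      eq₁ : ∀ j k → Even (lab α₁ +ℤ j +ℤ (k +ℤ + 1)) →
            T α₁ j (k +ℤ + 1) * T α₁ j (k -ℤ + 1)
              ≈ T α₁ (j +ℤ + 1) k * T α₁ (j -ℤ + 1) k + T α₂ j k
      eq₂ : ∀ j k → Even (lab α₂ +ℤ j +ℤ (k +ℤ + 1)) →
            T α₂ j (k +ℤ + 1) * T α₂ j (k -ℤ + 1)
              ≈ T α₂ (j +ℤ + 1) k * T α₂ (j -ℤ + 1) k + T α₁ j k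

  𝔄 : (Fin 2 → ℤ → ℤ → Carrier) → ℤ → Mat3
  𝔄 T t = matA (T α₁ t (+ 0)) (T α₁ (t +ℤ + 1) (+ 1)) (T α₂ t (+ 1)) (T α₂ (t +ℤ + 1) (+ 0))

  𝔅 : (Fin 2 → ℤ → ℤ → Carrier) → ℤ → Mat3
  𝔅 T t = matB (T α₁ t (+ 1)) (T α₁ (t +ℤ + 1) (+ 0)) (T α₂ t (+ 0)) (T α₂ (t +ℤ + 1) (+ 1))

  prodBA : (Fin 2 → ℤ → ℤ → Carrier) → ℤ → ℕ → Mat3
  prodBA T s nzero    = I3
  prodBA T s (nsuc m) = (𝔅 T (s +ℤ + 1) ⊗ 𝔄 T (s +ℤ + 2)) ⊗ prodBA T (s +ℤ + 2) m

module Submission where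

-- Write step T = 𝔅_0 ⊗ 𝔄_1 for the first factor of the products starting at
-- -1, translate T p for the solution moved by an even p along j, and raise T
-- for the solution with initial surface moved up by two (k ↦ k + 2).  The
-- proof rests on three local identities at the origin, for an explicit gauge
-- matrix G (module LocalIdentities):
--   gauge covariance   step T ⊗ G (translate T 2) ≈ G T ⊗ step (raise T),
--   first column       (step T)ᵢ₁ · T₁(2,1) ≈ (G T)ᵢ₁ · T₁(0,3),
--   first row          the first row of step T ⊗ G (translate T 2) is (1,0,0).
-- Each is a polynomial identity among values of T near the origin and their
-- inverses, proved as a linear combination of T-system relations and inverse
-- laws that the ring solver checks.  Iterating them along a product (module
-- Iteration) gives the theorem for products starting at -1, by induction on
-- the number of factors in steps of two, passing from T to raise (translate
-- T 2); translating by j - k + 1 gives the general case.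

open import Level using (Level; _⊔_)
open import Algebra.Bundles using (CommutativeRing)
open import Algebra.Solver.Ring.AlmostCommutativeRing
  using (fromCommutativeRing; _-Raw-AlmostCommutative⟶_)
open import Data.Fin using (Fin; zero; suc; #_)
open import Data.Maybe using (Maybe; just; nothing)
open import Data.Nat as ℕ using (ℕ) renaming (zero to nzero; suc to nsuc)
import Data.Nat.Properties as ℕP
open import Data.Integer as ℤ using (ℤ; +_; -[1+_]; _⊖_) renaming (_+_ to _+ℤ_; _-_ to _-ℤ_)
import Data.Integer.Properties as ℤP
open import Data.Product using (_,_)
open import Data.Sign as Sign using (Sign)
open import Data.Vec using (Vec; []; _∷_)
open import Relation.Binary.Bundles using (Setoid)
import Relation.Binary.Reasoning.Setoid
import Relation.Binary.PropositionalEquality as ≡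
open ≡ using (_≡_)
open import Relation.Nullary using (¬_; yes; no)
open import Defs

-- Every commutative ring receives the canonical ring map ℤ → R, which lets
-- the standard library's ring solver normalise polynomials with integer
-- coefficients over R.
module IntegerSolver {c ℓ : Level} (R : CommutativeRing c ℓ) where
  open CommutativeRing R
  open import Algebra.Properties.Ring ring
    using (-0#≈0#; -‿involutive; -‿+-comm; -‿distribˡ-*; -‿distribʳ-*)
  open import Algebra.Properties.Semiring.Mult.TCOptimised semiring
    using (_×_; 1+×; ×-homo-+; ×1-homo-*)
  open import Algebra.Properties.CommutativeSemigroup *-commutativeSemigroup
    using (interchange)
  open import Relation.Binary.Reasoning.Setoid setoid

  ⟦_⟧ℤ : ℤ → Carrier
  ⟦ + n ⟧ℤ      = n × 1#
  ⟦ -[1+ n ] ⟧ℤ = - (nsuc n × 1#)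

  private
    cancel-1# : ∀ a b → (1# + a) - (1# + b) ≈ a - b
    cancel-1# a b = begin
      (1# + a) - (1# + b)       ≈⟨ +-congˡ (-‿+-comm 1# b) ⟨
      (1# + a) + (- 1# + - b)   ≈⟨ +-assoc 1# a _ ⟩
      1# + (a + (- 1# + - b))   ≈⟨ +-congˡ (+-congˡ (+-comm (- 1#) (- b))) ⟩
      1# + (a + (- b + - 1#))   ≈⟨ +-congˡ (+-assoc a (- b) (- 1#)) ⟨
      1# + ((a - b) + - 1#)     ≈⟨ +-comm 1# _ ⟩
      ((a - b) + - 1#) + 1#     ≈⟨ +-assoc (a - b) (- 1#) 1# ⟩
      (a - b) + (- 1# + 1#)     ≈⟨ +-congˡ (-‿inverseˡ 1#) ⟩
      (a - b) + 0#              ≈⟨ +-identityʳ (a - b) ⟩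
      a - b                     ∎

    ⊖-homo : ∀ m n → ⟦ m ⊖ n ⟧ℤ ≈ m × 1# - n × 1#
    ⊖-homo m        nzero    = sym (trans (+-congˡ -0#≈0#) (+-identityʳ _))
    ⊖-homo nzero    (nsuc n) = sym (+-identityˡ _)
    ⊖-homo (nsuc m) (nsuc n) = begin
      ⟦ nsuc m ⊖ nsuc n ⟧ℤ             ≡⟨ ≡.cong ⟦_⟧ℤ (ℤP.[1+m]⊖[1+n]≡m⊖n m n) ⟩
      ⟦ m ⊖ n ⟧ℤ                       ≈⟨ ⊖-homo m n ⟩
      m × 1# - n × 1#                  ≈⟨ cancel-1# _ _ ⟨
      (1# + m × 1#) - (1# + n × 1#)    ≈⟨ +-cong (1+× m 1#) (-‿cong (1+× n 1#)) ⟨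
      nsuc m × 1# - nsuc n × 1#        ∎

    +-homo : ∀ i j → ⟦ i +ℤ j ⟧ℤ ≈ ⟦ i ⟧ℤ + ⟦ j ⟧ℤ
    +-homo (+ m)    (+ n)    = ×-homo-+ 1# m n
    +-homo (+ m)    -[1+ n ] = ⊖-homo m (nsuc n)
    +-homo -[1+ m ] (+ n)    = trans (⊖-homo n (nsuc m)) (+-comm _ _)
    +-homo -[1+ m ] -[1+ n ] = begin
      - (nsuc (nsuc (m ℕ.+ n)) × 1#)      ≡⟨ ≡.cong (λ k → - (nsuc k × 1#)) (ℕP.+-suc m n) ⟨
      - ((nsuc m ℕ.+ nsuc n) × 1#)        ≈⟨ -‿cong (×-homo-+ 1# (nsuc m) (nsuc n)) ⟩
      - (nsuc m × 1# + nsuc n × 1#)       ≈⟨ -‿+-comm _ _ ⟨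
      - (nsuc m × 1#) + - (nsuc n × 1#)   ∎

    -‿homo : ∀ i → ⟦ ℤ.- i ⟧ℤ ≈ - ⟦ i ⟧ℤ
    -‿homo (+ nzero)  = sym -0#≈0#
    -‿homo (+ nsuc n) = refl
    -‿homo -[1+ n ]   = sym (-‿involutive _)

    ◃-homo : ∀ s n → ⟦ s ℤ.◃ n ⟧ℤ ≈ ⟦ s ℤ.◃ 1 ⟧ℤ * (n × 1#)
    ◃-homo s      nzero    = sym (zeroʳ _)
    ◃-homo Sign.+ (nsuc n) = sym (*-identityˡ _)
    ◃-homo Sign.- (nsuc n) = trans (-‿cong (sym (*-identityˡ _))) (-‿distribˡ-* 1# _)

    sign-homo : ∀ s t → ⟦ (s Sign.* t) ℤ.◃ 1 ⟧ℤ ≈ ⟦ s ℤ.◃ 1 ⟧ℤ * ⟦ t ℤ.◃ 1 ⟧ℤ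
    sign-homo Sign.+ Sign.+ = sym (*-identityˡ _)
    sign-homo Sign.+ Sign.- = sym (*-identityˡ _)
    sign-homo Sign.- Sign.+ = sym (*-identityʳ _)
    sign-homo Sign.- Sign.- = begin
      1#              ≈⟨ -‿involutive 1# ⟨
      - - 1#          ≈⟨ -‿cong (-‿cong (*-identityʳ 1#)) ⟨
      - - (1# * 1#)   ≈⟨ -‿cong (-‿distribˡ-* 1# 1#) ⟩
      - (- 1# * 1#)   ≈⟨ -‿distribʳ-* (- 1#) 1# ⟩
      - 1# * - 1#     ∎

    sign-abs : ∀ i → ⟦ i ⟧ℤ ≈ ⟦ ℤ.sign i ℤ.◃ 1 ⟧ℤ * (ℤ.∣ i ∣ × 1#)
    sign-abs i = trans (reflexive (≡.cong ⟦_⟧ℤ (≡.sym (ℤP.◃-inverse i))))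
                       (◃-homo (ℤ.sign i) ℤ.∣ i ∣)

    *-homo : ∀ i j → ⟦ i ℤ.* j ⟧ℤ ≈ ⟦ i ⟧ℤ * ⟦ j ⟧ℤ
    *-homo i j = begin
      ⟦ (s Sign.* t) ℤ.◃ (ℤ.∣ i ∣ ℕ.* ℤ.∣ j ∣) ⟧ℤ            ≈⟨ ◃-homo (s Sign.* t) (ℤ.∣ i ∣ ℕ.* ℤ.∣ j ∣) ⟩
      ⟦ (s Sign.* t) ℤ.◃ 1 ⟧ℤ * ((ℤ.∣ i ∣ ℕ.* ℤ.∣ j ∣) × 1#)  ≈⟨ *-cong (sign-homo s t) (×1-homo-* ℤ.∣ i ∣ ℤ.∣ j ∣) ⟩
      (σ s * σ t) * (∣ i ∣′ * ∣ j ∣′)                        ≈⟨ interchange (σ s) (σ t) ∣ i ∣′ ∣ j ∣′ ⟩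
      (σ s * ∣ i ∣′) * (σ t * ∣ j ∣′)                        ≈⟨ *-cong (sign-abs i) (sign-abs j) ⟨
      ⟦ i ⟧ℤ * ⟦ j ⟧ℤ                                        ∎
      where
      s = ℤ.sign i
      t = ℤ.sign j
      σ : Sign → Carrier
      σ u = ⟦ u ℤ.◃ 1 ⟧ℤ
      ∣_∣′ : ℤ → Carrier
      ∣ k ∣′ = ℤ.∣ k ∣ × 1#

    homomorphism : ℤ.+-*-rawRing -Raw-AlmostCommutative⟶ fromCommutativeRing R
    homomorphism = record
      { ⟦_⟧ = ⟦_⟧ℤ ; +-homo = +-homo ; *-homo = *-homo ; -‿homo = -‿homo
      ; 0-homo = refl ; 1-homo = refl }

    ⟦⟧ℤ-≟ : ∀ i j → Maybe (⟦ i ⟧ℤ ≈ ⟦ j ⟧ℤ)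
    ⟦⟧ℤ-≟ i j with i ℤ.≟ j
    ... | yes ≡.refl = just refl
    ... | no _       = nothing

  open import Algebra.Solver.Ring ℤ.+-*-rawRing (fromCommutativeRing R) homomorphism ⟦⟧ℤ-≟ public

-- Proof "by linear combination": L ≈ R follows from hypotheses lᵢ ≈ rᵢ
-- whenever L + Σ wᵢ·rᵢ and R + Σ wᵢ·lᵢ have the same normal form for some
-- polynomial weights wᵢ.  All polynomials are evaluated in a fixed
-- environment ρ, so hypotheses may be arbitrary facts about its values.
module LinearCombination {c ℓ : Level} (R : CommutativeRing c ℓ)
    {n : ℕ} (ρ : Vec (CommutativeRing.Carrier R) n) where
  open CommutativeRing R
  open IntegerSolver R
  open import Algebra.Properties.Ring ring using (+-cancelʳ)

  infix 4 _≋_by_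
  record Equation : Set (c ⊔ ℓ) where
    constructor _≋_by_
    field
      lhs rhs : Polynomial n
      holds   : ⟦ lhs ⟧ ρ ≈ ⟦ rhs ⟧ ρ

  infixr 5 _⋆_∷_
  data Combination : Set (c ⊔ ℓ) where
    []    : Combination
    _⋆_∷_ : Polynomial n → Equation → Combination → Combination

  Σlhs Σrhs : Combination → Polynomial n
  Σlhs []             = con (+ 0)
  Σlhs (w ⋆ e ∷ ws)   = w :* Equation.lhs e :+ Σlhs ws
  Σrhs []             = con (+ 0)
  Σrhs (w ⋆ e ∷ ws)   = w :* Equation.rhs e :+ Σrhs ws

  Σ-holds : ∀ ws → ⟦ Σlhs ws ⟧ ρ ≈ ⟦ Σrhs ws ⟧ ρ
  Σ-holds []           = refl
  Σ-holds (w ⋆ e ∷ ws) = +-cong (*-congˡ (Equation.holds e)) (Σ-holds ws)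

  by-combination : ∀ L R′ ws →
    ⟦ L :+ Σrhs ws ⟧↓ ρ ≈ ⟦ R′ :+ Σlhs ws ⟧↓ ρ → ⟦ L ⟧ ρ ≈ ⟦ R′ ⟧ ρ
  by-combination L R′ ws nf = +-cancelʳ (⟦ Σrhs ws ⟧ ρ) _ _
    (trans (prove ρ (L :+ Σrhs ws) (R′ :+ Σlhs ws) nf) (+-congˡ (Σ-holds ws)))

module FieldProperties {c ℓ : Level} (F : Field c ℓ) where
  open Field F hiding (zero)
  open FieldDefs F using (_÷_)
  open IntegerSolver commutativeRing using (solve; _:=_; _:*_)
  open import Relation.Binary.Reasoning.Setoid setoid

  ÷-*-cancel : ∀ {x y} → ¬ y ≈ 0# → (x ÷ y) * y ≈ x
  ÷-*-cancel {x} {y} y≉0 = begin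
    (x * y ⁻¹) * y    ≈⟨ solve 3 (λ x y y′ → (x :* y′) :* y := x :* (y :* y′)) refl x y (y ⁻¹) ⟩
    x * (y * y ⁻¹)    ≈⟨ *-congˡ (⁻¹-inverse y y≉0) ⟩
    x * 1#            ≈⟨ *-identityʳ x ⟩
    x                 ∎

  *-nonzero : ∀ {x y} → ¬ x ≈ 0# → ¬ y ≈ 0# → ¬ x * y ≈ 0#
  *-nonzero {x} {y} x≉0 y≉0 xy≈0 = x≉0 (begin
    x                 ≈⟨ ÷-*-cancel y≉0 ⟨
    (x * y ⁻¹) * y    ≈⟨ solve 3 (λ x y y′ → (x :* y′) :* y := (x :* y) :* y′) refl x y (y ⁻¹) ⟩
    (x * y) * y ⁻¹    ≈⟨ *-congʳ xy≈0 ⟩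
    0# * y ⁻¹         ≈⟨ zeroˡ _ ⟩
    0#                ∎)

  ⁻¹-unique : ∀ {x y} → ¬ x ≈ 0# → x * y ≈ 1# → y ≈ x ⁻¹
  ⁻¹-unique {x} {y} x≉0 xy≈1 = begin
    y                  ≈⟨ *-identityʳ y ⟨
    y * 1#             ≈⟨ *-congˡ (⁻¹-inverse x x≉0) ⟨
    y * (x * x ⁻¹)     ≈⟨ solve 3 (λ x y x′ → y :* (x :* x′) := (x :* y) :* x′) refl x y (x ⁻¹) ⟩
    (x * y) * x ⁻¹     ≈⟨ *-congʳ xy≈1 ⟩
    1# * x ⁻¹          ≈⟨ *-identityˡ _ ⟩
    x ⁻¹               ∎

  ⁻¹-*-distrib : ∀ {x y} → ¬ x ≈ 0# → ¬ y ≈ 0# → (x * y) ⁻¹ ≈ x ⁻¹ * y ⁻¹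
  ⁻¹-*-distrib {x} {y} x≉0 y≉0 = sym (⁻¹-unique (*-nonzero x≉0 y≉0) (begin
    (x * y) * (x ⁻¹ * y ⁻¹)   ≈⟨ solve 4 (λ x y x′ y′ → (x :* y) :* (x′ :* y′) := (x :* x′) :* (y :* y′))
                                   refl x y (x ⁻¹) (y ⁻¹) ⟩
    (x * x ⁻¹) * (y * y ⁻¹)   ≈⟨ *-cong (⁻¹-inverse x x≉0) (⁻¹-inverse y y≉0) ⟩
    1# * 1#                   ≈⟨ *-identityˡ 1# ⟩
    1#                        ∎))

entries₃ : ∀ {p} {P : Fin 3 → Set p} → P zero → P (suc zero) → P (suc (suc zero)) → ∀ i → P i
entries₃ p₀ p₁ p₂ zero             = p₀
entries₃ p₀ p₁ p₂ (suc zero)       = p₁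
entries₃ p₀ p₁ p₂ (suc (suc zero)) = p₂

entries₃ₓ₃ : ∀ {p} {P : Fin 3 → Fin 3 → Set p} →
  P zero zero → P zero (suc zero) → P zero (suc (suc zero)) →
  P (suc zero) zero → P (suc zero) (suc zero) → P (suc zero) (suc (suc zero)) →
  P (suc (suc zero)) zero → P (suc (suc zero)) (suc zero) → P (suc (suc zero)) (suc (suc zero)) →
  ∀ i k → P i k
entries₃ₓ₃ p₀₀ p₀₁ p₀₂ p₁₀ p₁₁ p₁₂ p₂₀ p₂₁ p₂₂ =
  entries₃ (entries₃ p₀₀ p₀₁ p₀₂) (entries₃ p₁₀ p₁₁ p₁₂) (entries₃ p₂₀ p₂₁ p₂₂)

-- The product
-- is written through the three-term sum Σ₃, so (M ⊗ N) i k is by definition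
-- Σ₃ (λ l → M i l * N l k).
module Matrices {c ℓ : Level} (F : Field c ℓ) where
  open Field F hiding (zero)
  open FieldDefs F
  open IntegerSolver commutativeRing using (solve; _:=_; _:+_; _:*_; con)
  open import Relation.Binary.Reasoning.Setoid setoid

  Σ₃ : (Fin 3 → Carrier) → Carrier
  Σ₃ f = f zero + (f (suc zero) + f (suc (suc zero)))

  Σ₃-cong : ∀ {f g} → (∀ l → f l ≈ g l) → Σ₃ f ≈ Σ₃ g
  Σ₃-cong f≈g = +-cong (f≈g zero) (+-cong (f≈g (suc zero)) (f≈g (suc (suc zero))))

  Σ₃-*ʳ : ∀ (f : Fin 3 → Carrier) x → Σ₃ f * x ≈ Σ₃ (λ l → f l * x)
  Σ₃-*ʳ f x = solve 4 (λ a b c x → (a :+ (b :+ c)) :* x := a :* x :+ (b :* x :+ c :* x))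
                refl (f zero) (f (suc zero)) (f (suc (suc zero))) x

  Σ₃-*ˡ : ∀ x (f : Fin 3 → Carrier) → x * Σ₃ f ≈ Σ₃ (λ l → x * f l)
  Σ₃-*ˡ x f = solve 4 (λ x a b c → x :* (a :+ (b :+ c)) := x :* a :+ (x :* b :+ x :* c))
                refl x (f zero) (f (suc zero)) (f (suc (suc zero)))

  Σ₃-swap : ∀ (g : Fin 3 → Fin 3 → Carrier) → Σ₃ (λ j → Σ₃ (λ l → g l j)) ≈ Σ₃ (λ l → Σ₃ (λ j → g l j))
  Σ₃-swap g = solve 9
    (λ a₀₀ a₀₁ a₀₂ a₁₀ a₁₁ a₁₂ a₂₀ a₂₁ a₂₂ →
       (a₀₀ :+ (a₁₀ :+ a₂₀)) :+ ((a₀₁ :+ (a₁₁ :+ a₂₁)) :+ (a₀₂ :+ (a₁₂ :+ a₂₂)))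
       := (a₀₀ :+ (a₀₁ :+ a₀₂)) :+ ((a₁₀ :+ (a₁₁ :+ a₁₂)) :+ (a₂₀ :+ (a₂₁ :+ a₂₂))))
    refl (g zero zero) (g zero (suc zero)) (g zero (suc (suc zero)))
         (g (suc zero) zero) (g (suc zero) (suc zero)) (g (suc zero) (suc (suc zero)))
         (g (suc (suc zero)) zero) (g (suc (suc zero)) (suc zero)) (g (suc (suc zero)) (suc (suc zero)))

  infix 4 _≈ₘ_
  _≈ₘ_ : Mat3 → Mat3 → Set ℓ
  M ≈ₘ N = ∀ i k → M i k ≈ N i k

  matrixSetoid : Setoid c ℓ
  matrixSetoid = record
    { Carrier       = Mat3
    ; _≈_           = _≈ₘ_
    ; isEquivalence = record
      { refl  = λ i k → refl
      ; sym   = λ M≈N i k → sym (M≈N i k)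
      ; trans = λ M≈N N≈Q i k → trans (M≈N i k) (N≈Q i k) } }

  open Setoid matrixSetoid public
    using () renaming (refl to ≈ₘ-refl; sym to ≈ₘ-sym; trans to ≈ₘ-trans; reflexive to ≈ₘ-reflexive)

  ⊗-cong : ∀ {M M′ N N′} → M ≈ₘ M′ → N ≈ₘ N′ → M ⊗ N ≈ₘ M′ ⊗ N′
  ⊗-cong M≈M′ N≈N′ i k = Σ₃-cong (λ l → *-cong (M≈M′ i l) (N≈N′ l k))

  ⊗-assoc : ∀ M N Q → (M ⊗ N) ⊗ Q ≈ₘ M ⊗ (N ⊗ Q)
  ⊗-assoc M N Q i k = begin
    Σ₃ (λ j → Σ₃ (λ l → M i l * N l j) * Q j k)     ≈⟨ Σ₃-cong (λ j → Σ₃-*ʳ (λ l → M i l * N l j) (Q j k)) ⟩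
    Σ₃ (λ j → Σ₃ (λ l → (M i l * N l j) * Q j k))   ≈⟨ Σ₃-cong (λ j → Σ₃-cong (λ l → *-assoc (M i l) (N l j) (Q j k))) ⟩
    Σ₃ (λ j → Σ₃ (λ l → M i l * (N l j * Q j k)))   ≈⟨ Σ₃-swap (λ l j → M i l * (N l j * Q j k)) ⟩
    Σ₃ (λ l → Σ₃ (λ j → M i l * (N l j * Q j k)))   ≈⟨ Σ₃-cong (λ l → Σ₃-*ˡ (M i l) (λ j → N l j * Q j k)) ⟨
    Σ₃ (λ l → M i l * Σ₃ (λ j → N l j * Q j k))     ∎

  Σ₃-I3ˡ : ∀ l f → Σ₃ (λ j → I3 l j * f j) ≈ f l
  Σ₃-I3ˡ = entries₃ {P = λ l → ∀ (f : Fin 3 → Carrier) → Σ₃ (λ j → I3 l j * f j) ≈ f l}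
    (λ f → solve 3 (λ a b c → ı :* a :+ (o :* b :+ o :* c) := a) refl (f zero) (f (suc zero)) (f (suc (suc zero))))
    (λ f → solve 3 (λ a b c → o :* a :+ (ı :* b :+ o :* c) := b) refl (f zero) (f (suc zero)) (f (suc (suc zero))))
    (λ f → solve 3 (λ a b c → o :* a :+ (o :* b :+ ı :* c) := c) refl (f zero) (f (suc zero)) (f (suc (suc zero))))
    where ı = con (+ 1); o = con (+ 0)

  Σ₃-I3ʳ : ∀ l f → Σ₃ (λ j → f j * I3 j l) ≈ f l
  Σ₃-I3ʳ = entries₃ {P = λ l → ∀ (f : Fin 3 → Carrier) → Σ₃ (λ j → f j * I3 j l) ≈ f l}
    (λ f → solve 3 (λ a b c → a :* ı :+ (b :* o :+ c :* o) := a) refl (f zero) (f (suc zero)) (f (suc (suc zero))))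
    (λ f → solve 3 (λ a b c → a :* o :+ (b :* ı :+ c :* o) := b) refl (f zero) (f (suc zero)) (f (suc (suc zero))))
    (λ f → solve 3 (λ a b c → a :* o :+ (b :* o :+ c :* ı) := c) refl (f zero) (f (suc zero)) (f (suc (suc zero))))
    where ı = con (+ 1); o = con (+ 0)

  ⊗-identityˡ : ∀ M → I3 ⊗ M ≈ₘ M
  ⊗-identityˡ M i k = Σ₃-I3ˡ i (λ j → M j k)

  ⊗-identityʳ : ∀ M → M ⊗ I3 ≈ₘ M
  ⊗-identityʳ M i k = Σ₃-I3ʳ k (M i)

  ⊗-column : ∀ {X Y x y} k → (∀ l → X l k * x ≈ Y l k * y) →
             ∀ M i → (M ⊗ X) i k * x ≈ (M ⊗ Y) i k * y
  ⊗-column {X} {Y} {x} {y} k X≈Y M i = begin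
    Σ₃ (λ l → M i l * X l k) * x       ≈⟨ Σ₃-*ʳ (λ l → M i l * X l k) x ⟩
    Σ₃ (λ l → (M i l * X l k) * x)     ≈⟨ Σ₃-cong (λ l → *-assoc (M i l) (X l k) x) ⟩
    Σ₃ (λ l → M i l * (X l k * x))     ≈⟨ Σ₃-cong (λ l → *-congˡ {M i l} (X≈Y l)) ⟩
    Σ₃ (λ l → M i l * (Y l k * y))     ≈⟨ Σ₃-cong (λ l → *-assoc (M i l) (Y l k) y) ⟨
    Σ₃ (λ l → (M i l * Y l k) * y)     ≈⟨ Σ₃-*ʳ (λ l → M i l * Y l k) y ⟨
    Σ₃ (λ l → M i l * Y l k) * y       ∎

  ⊗-row : ∀ {A B} i → (∀ l → A i l ≈ B i l) → ∀ N k → (A ⊗ N) i k ≈ (B ⊗ N) i k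
  ⊗-row i A≈B N k = Σ₃-cong (λ l → *-congʳ {N l k} (A≈B l))

module Parity where
  open import Data.Integer.Tactic.RingSolver using (solve-∀)

  even-+ : ∀ {a b} → Even a → Even b → Even (a +ℤ b)
  even-+ (x , ≡.refl) (y , ≡.refl) = x +ℤ y , regroup x y
    where
    regroup : ∀ x y → (x +ℤ x) +ℤ (y +ℤ y) ≡ (x +ℤ y) +ℤ (x +ℤ y)
    regroup = solve-∀

  even-2 : Even (+ 2)
  even-2 = + 1 , ≡.refl

  even-cancel : ∀ {a} b → Even (a +ℤ (b +ℤ b)) → Even a
  even-cancel {a} b (x , eq) = x -ℤ b , (begin
    a                            ≡⟨ cancel a b ⟨
    (a +ℤ (b +ℤ b)) -ℤ (b +ℤ b)  ≡⟨ ≡.cong (λ z → z -ℤ (b +ℤ b)) eq ⟩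
    (x +ℤ x) -ℤ (b +ℤ b)         ≡⟨ regroup x b ⟩
    (x -ℤ b) +ℤ (x -ℤ b)         ∎)
    where
    open ≡.≡-Reasoning
    cancel : ∀ a b → (a +ℤ (b +ℤ b)) -ℤ (b +ℤ b) ≡ a
    cancel = solve-∀
    regroup : ∀ x b → (x +ℤ x) -ℤ (b +ℤ b) ≡ (x -ℤ b) +ℤ (x -ℤ b)
    regroup = solve-∀

module Symmetries {c ℓ : Level} (F : Field c ℓ) where
  open Field F hiding (zero)
  open FieldDefs F
  open Matrices F
  open Parity
  open import Data.Integer.Tactic.RingSolver using (solve-∀)

  Solution : (Fin 2 → ℤ → ℤ → Carrier) → Set (c ⊔ ℓ)
  Solution = IsA2TSystemSolution

  translate : (Fin 2 → ℤ → ℤ → Carrier) → ℤ → Fin 2 → ℤ → ℤ → Carrier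
  translate T p α j k = T α (p +ℤ j) k

  raise : (Fin 2 → ℤ → ℤ → Carrier) → Fin 2 → ℤ → ℤ → Carrier
  raise T α j k = T α j (+ 2 +ℤ k)

  Relation : (Fin 2 → ℤ → ℤ → Carrier) → Fin 2 → Fin 2 → ℤ → ℤ → Set ℓ
  Relation T α β j k =
    T α j (k +ℤ + 1) * T α j (k -ℤ + 1) ≈ T α (j +ℤ + 1) k * T α (j -ℤ + 1) k + T β j k

  translate-relation : ∀ T p α β j k → Relation T α β (p +ℤ j) k → Relation (translate T p) α β j k
  translate-relation T p α β j k rel = trans rel (reflexive (≡.cong₂
    (λ j₊ j₋ → T α j₊ k * T α j₋ k + T β (p +ℤ j) k) (ℤP.+-assoc p j (+ 1)) (ℤP.+-assoc p j -[1+ 0 ])))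

  raise-relation : ∀ T α β j k → Relation T α β j (+ 2 +ℤ k) → Relation (raise T) α β j k
  raise-relation T α β j k rel = trans (reflexive (≡.cong₂
    (λ k₊ k₋ → T α j k₊ * T α j k₋) (≡.sym (ℤP.+-assoc (+ 2) k (+ 1))) (≡.sym (ℤP.+-assoc (+ 2) k -[1+ 0 ])))) rel

  translate-solution : ∀ {T p} → Even p → Solution T → Solution (translate T p)
  translate-solution {T} {p} even-p sol = record
    { nonzero = λ α j k e → nonzero α (p +ℤ j) k (moved (lab α) j k e)
    ; eq₁ = λ j k e → translate-relation T p α₁ α₂ j k (eq₁ (p +ℤ j) k (moved (lab α₁) j (k +ℤ + 1) e))
    ; eq₂ = λ j k e → translate-relation T p α₂ α₁ j k (eq₂ (p +ℤ j) k (moved (lab α₂) j (k +ℤ + 1) e))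
    }
    where
    open IsA2TSystemSolution sol
    regroup : ∀ p a j k → p +ℤ (a +ℤ j +ℤ k) ≡ a +ℤ (p +ℤ j) +ℤ k
    regroup = solve-∀
    moved : ∀ a j k → Even (a +ℤ j +ℤ k) → Even (a +ℤ (p +ℤ j) +ℤ k)
    moved a j k e = ≡.subst Even (regroup p a j k) (even-+ even-p e)

  raise-solution : ∀ {T} → Solution T → Solution (raise T)
  raise-solution {T} sol = record
    { nonzero = λ α j k e → nonzero α j (+ 2 +ℤ k) (raised (lab α) j k e)
    ; eq₁ = λ j k e → raise-relation T α₁ α₂ j k (eq₁ j (+ 2 +ℤ k) (raised′ (lab α₁) j k e))
    ; eq₂ = λ j k e → raise-relation T α₂ α₁ j k (eq₂ j (+ 2 +ℤ k) (raised′ (lab α₂) j k e))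
    }
    where
    open IsA2TSystemSolution sol
    regroup : ∀ a j k → (a +ℤ j +ℤ k) +ℤ + 2 ≡ a +ℤ j +ℤ (+ 2 +ℤ k)
    regroup = solve-∀
    regroup′ : ∀ a j k → (a +ℤ j +ℤ (k +ℤ + 1)) +ℤ + 2 ≡ a +ℤ j +ℤ ((+ 2 +ℤ k) +ℤ + 1)
    regroup′ = solve-∀
    raised : ∀ a j k → Even (a +ℤ j +ℤ k) → Even (a +ℤ j +ℤ (+ 2 +ℤ k))
    raised a j k e = ≡.subst Even (regroup a j k) (even-+ e even-2)
    raised′ : ∀ a j k → Even (a +ℤ j +ℤ (k +ℤ + 1)) → Even (a +ℤ j +ℤ ((+ 2 +ℤ k) +ℤ + 1))
    raised′ a j k e = ≡.subst Even (regroup′ a j k) (even-+ e even-2)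

  𝔅-translate : ∀ T p t → 𝔅 (translate T p) t ≡ 𝔅 T (p +ℤ t)
  𝔅-translate T p t = ≡.cong (λ t₊ → matB (T α₁ (p +ℤ t) (+ 1)) (T α₁ t₊ (+ 0)) (T α₂ (p +ℤ t) (+ 0)) (T α₂ t₊ (+ 1)))
                             (≡.sym (ℤP.+-assoc p t (+ 1)))

  𝔄-translate : ∀ T p t → 𝔄 (translate T p) t ≡ 𝔄 T (p +ℤ t)
  𝔄-translate T p t = ≡.cong (λ t₊ → matA (T α₁ (p +ℤ t) (+ 0)) (T α₁ t₊ (+ 1)) (T α₂ (p +ℤ t) (+ 1)) (T α₂ t₊ (+ 0)))
                             (≡.sym (ℤP.+-assoc p t (+ 1)))

  prodBA-translate : ∀ T p s m → prodBA (translate T p) s m ≈ₘ prodBA T (p +ℤ s) m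
  prodBA-translate T p s nzero    = ≈ₘ-refl
  prodBA-translate T p s (nsuc m) = ⊗-cong (⊗-cong 𝔅≈ 𝔄≈) rest
    where
    𝔅≈ : 𝔅 (translate T p) (s +ℤ + 1) ≈ₘ 𝔅 T ((p +ℤ s) +ℤ + 1)
    𝔅≈ = ≈ₘ-reflexive (≡.trans (𝔅-translate T p (s +ℤ + 1)) (≡.cong (𝔅 T) (≡.sym (ℤP.+-assoc p s (+ 1)))))
    𝔄≈ : 𝔄 (translate T p) (s +ℤ + 2) ≈ₘ 𝔄 T ((p +ℤ s) +ℤ + 2)
    𝔄≈ = ≈ₘ-reflexive (≡.trans (𝔄-translate T p (s +ℤ + 2)) (≡.cong (𝔄 T) (≡.sym (ℤP.+-assoc p s (+ 2)))))
    rest : prodBA (translate T p) (s +ℤ + 2) m ≈ₘ prodBA T ((p +ℤ s) +ℤ + 2) m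
    rest = ≈ₘ-trans (prodBA-translate T p (s +ℤ + 2) m)
                    (≈ₘ-reflexive (≡.cong (λ t → prodBA T t m) (≡.sym (ℤP.+-assoc p s (+ 2)))))

-- The gauge matrix
-- gauge T (at the origin) intertwines the step of T with the step of the
-- raised solution: step T ⊗ gauge (translate T 2) ≈ gauge T ⊗ step (raise T).
module Gauge {c ℓ : Level} (F : Field c ℓ) where
  open Field F hiding (zero)
  open FieldDefs F

  step : (Fin 2 → ℤ → ℤ → Carrier) → Mat3
  step T = 𝔅 T (+ 0) ⊗ 𝔄 T (+ 1)

  gauge : (Fin 2 → ℤ → ℤ → Carrier) → Mat3
  gauge T zero          zero          = T α₁ (+ 1) (+ 2) ÷ T α₁ (+ 0) (+ 3)
  gauge T zero          (suc zero)    = - (1# ÷ T α₁ (+ 0) (+ 3))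
  gauge T zero          (suc (suc _)) = 0#
  gauge T (suc zero)    zero          = T α₂ (+ 1) (+ 1) ÷ T α₁ (+ 0) (+ 3)
  gauge T (suc zero)    (suc zero)    = (T α₁ -[1+ 0 ] (+ 2) ÷ T α₁ (+ 0) (+ 3)) * (T α₂ (+ 1) (+ 1) ÷ T α₂ (+ 0) (+ 2))
  gauge T (suc zero)    (suc (suc _)) = - (T α₁ (+ 0) (+ 1) ÷ T α₂ (+ 0) (+ 2))
  gauge T (suc (suc _)) zero          = 1# ÷ T α₁ (+ 0) (+ 3)
  gauge T (suc (suc _)) (suc zero)    = (T α₁ -[1+ 0 ] (+ 2) ÷ T α₁ (+ 0) (+ 3)) ÷ T α₂ (+ 0) (+ 2)
  gauge T (suc (suc _)) (suc (suc _)) = T α₂ -[1+ 0 ] (+ 1) ÷ T α₂ (+ 0) (+ 2)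

-- Copies of the matrices with entries polynomials (over the ring solver) in
-- variables standing for values of T and their inverses; evaluating a copy
-- in an environment gives back the matrix of field elements.
module PolynomialMatrices {c ℓ : Level} (F : Field c ℓ) {n : ℕ} where
  open Field F hiding (zero)
  open FieldDefs F using (Mat3)
  open IntegerSolver commutativeRing using (Polynomial; con; _:+_; _:*_; :-_; ⟦_⟧)

  PolyMat : Set
  PolyMat = Fin 3 → Fin 3 → Polynomial n

  ⟦_⟧ₘ : PolyMat → Vec Carrier n → Mat3
  ⟦ M ⟧ₘ ρ i k = ⟦ M i k ⟧ ρ

  infixl 7 _⊗ₚ_
  _⊗ₚ_ : PolyMat → PolyMat → PolyMat
  (M ⊗ₚ N) i k = M i zero :* N zero k :+ (M i (suc zero) :* N (suc zero) k :+ M i (suc (suc zero)) :* N (suc (suc zero)) k)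

  private
    ı o : Polynomial n
    ı = con (+ 1)
    o = con (+ 0)

  I3ₚ : PolyMat
  I3ₚ zero          zero          = ı
  I3ₚ (suc zero)    (suc zero)    = ı
  I3ₚ (suc (suc _)) (suc (suc _)) = ı
  I3ₚ _             _             = o

  matBₚ : (a b⁻¹ u v⁻¹ : Polynomial n) → PolyMat
  matBₚ a b⁻¹ u v⁻¹ zero          zero          = a :* b⁻¹
  matBₚ a b⁻¹ u v⁻¹ zero          (suc zero)    = ı :* b⁻¹
  matBₚ a b⁻¹ u v⁻¹ zero          (suc (suc _)) = o
  matBₚ a b⁻¹ u v⁻¹ (suc zero)    zero          = o
  matBₚ a b⁻¹ u v⁻¹ (suc zero)    (suc zero)    = ı
  matBₚ a b⁻¹ u v⁻¹ (suc zero)    (suc (suc _)) = o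
  matBₚ a b⁻¹ u v⁻¹ (suc (suc _)) zero          = o
  matBₚ a b⁻¹ u v⁻¹ (suc (suc _)) (suc zero)    = ı :* v⁻¹
  matBₚ a b⁻¹ u v⁻¹ (suc (suc _)) (suc (suc _)) = u :* v⁻¹

  matAₚ : (a u b⁻¹ v⁻¹ bv⁻¹ : Polynomial n) → PolyMat
  matAₚ a u b⁻¹ v⁻¹ bv⁻¹ zero          zero          = ı
  matAₚ a u b⁻¹ v⁻¹ bv⁻¹ zero          (suc _)       = o
  matAₚ a u b⁻¹ v⁻¹ bv⁻¹ (suc zero)    zero          = u :* b⁻¹
  matAₚ a u b⁻¹ v⁻¹ bv⁻¹ (suc zero)    (suc zero)    = (a :* u) :* bv⁻¹
  matAₚ a u b⁻¹ v⁻¹ bv⁻¹ (suc zero)    (suc (suc _)) = a :* v⁻¹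
  matAₚ a u b⁻¹ v⁻¹ bv⁻¹ (suc (suc _)) zero          = o
  matAₚ a u b⁻¹ v⁻¹ bv⁻¹ (suc (suc _)) (suc zero)    = o
  matAₚ a u b⁻¹ v⁻¹ bv⁻¹ (suc (suc _)) (suc (suc _)) = ı

  -- gauge T, given T₁(1,2), T₁(0,3)⁻¹, T₂(1,1), T₁(-1,2), T₂(0,2)⁻¹, T₁(0,1), T₂(-1,1).
  gaugeₚ : (a b⁻¹ u d e⁻¹ f g : Polynomial n) → PolyMat
  gaugeₚ a b⁻¹ u d e⁻¹ f g zero          zero          = a :* b⁻¹
  gaugeₚ a b⁻¹ u d e⁻¹ f g zero          (suc zero)    = :- (ı :* b⁻¹)
  gaugeₚ a b⁻¹ u d e⁻¹ f g zero          (suc (suc _)) = o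
  gaugeₚ a b⁻¹ u d e⁻¹ f g (suc zero)    zero          = u :* b⁻¹
  gaugeₚ a b⁻¹ u d e⁻¹ f g (suc zero)    (suc zero)    = (d :* b⁻¹) :* (u :* e⁻¹)
  gaugeₚ a b⁻¹ u d e⁻¹ f g (suc zero)    (suc (suc _)) = :- (f :* e⁻¹)
  gaugeₚ a b⁻¹ u d e⁻¹ f g (suc (suc _)) zero          = ı :* b⁻¹
  gaugeₚ a b⁻¹ u d e⁻¹ f g (suc (suc _)) (suc zero)    = (d :* b⁻¹) :* e⁻¹
  gaugeₚ a b⁻¹ u d e⁻¹ f g (suc (suc _)) (suc (suc _)) = g :* e⁻¹

-- Each entry of each identity is a
-- polynomial identity in the values of T near the origin and their inverses,
-- which follows from six instances of the T-system relations and the inverse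
-- laws; the weights of these hypotheses are listed entry by entry, and the
-- ring solver checks each resulting linear combination.
module LocalIdentities {c ℓ : Level} (F : Field c ℓ)
    (T : Fin 2 → ℤ → ℤ → Field.Carrier F) (sol : Symmetries.Solution F T) where
  open Field F hiding (zero)
  open FieldDefs F
  open FieldProperties F
  open Matrices F
  open Symmetries F
  open Gauge F
  open IntegerSolver commutativeRing using (Polynomial; var; con; _:+_; _:-_; _:*_; :-_; ⟦_⟧; ⟦_⟧↓)
  open IsA2TSystemSolution sol

  ρ : Vec Carrier 28
  ρ = T α₁ -[1+ 0 ] (+ 2)
    ∷ T α₁ (+ 0) (+ 1)
    ∷ T α₁ (+ 0) (+ 3)
    ∷ T α₁ (+ 1) (+ 0)
    ∷ T α₁ (+ 1) (+ 2)
    ∷ T α₁ (+ 2) (+ 1)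
    ∷ T α₁ (+ 2) (+ 3)
    ∷ T α₁ (+ 3) (+ 2)
    ∷ T α₂ -[1+ 0 ] (+ 1)
    ∷ T α₂ (+ 0) (+ 0)
    ∷ T α₂ (+ 0) (+ 2)
    ∷ T α₂ (+ 1) (+ 1)
    ∷ T α₂ (+ 1) (+ 3)
    ∷ T α₂ (+ 2) (+ 0)
    ∷ T α₂ (+ 2) (+ 2)
    ∷ T α₂ (+ 3) (+ 1)
    ∷ (T α₁ (+ 0) (+ 3)) ⁻¹
    ∷ (T α₁ (+ 1) (+ 0)) ⁻¹
    ∷ (T α₁ (+ 1) (+ 2)) ⁻¹
    ∷ (T α₁ (+ 2) (+ 1)) ⁻¹
    ∷ (T α₁ (+ 2) (+ 3)) ⁻¹
    ∷ (T α₂ (+ 0) (+ 2)) ⁻¹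
    ∷ (T α₂ (+ 1) (+ 1)) ⁻¹
    ∷ (T α₂ (+ 1) (+ 3)) ⁻¹
    ∷ (T α₂ (+ 2) (+ 0)) ⁻¹
    ∷ (T α₂ (+ 2) (+ 2)) ⁻¹
    ∷ (T α₁ (+ 2) (+ 1) * T α₂ (+ 2) (+ 0)) ⁻¹
    ∷ (T α₁ (+ 2) (+ 3) * T α₂ (+ 2) (+ 2)) ⁻¹
    ∷ []

  -- Solver variables for these values: xⱼₖ stands for T₁(j,k), yⱼₖ for T₂(j,k),
  -- a⁻¹ for the inverse of a, and ⟨ab⟩⁻¹ for the inverse of a product.
  x₋₁₂ x₀₁ x₀₃ x₁₀ x₁₂ x₂₁ x₂₃ x₃₂ : Polynomial 28
  y₋₁₁ y₀₀ y₀₂ y₁₁ y₁₃ y₂₀ y₂₂ y₃₁ : Polynomial 28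
  x₀₃⁻¹ x₁₀⁻¹ x₁₂⁻¹ x₂₁⁻¹ x₂₃⁻¹ y₀₂⁻¹ y₁₁⁻¹ y₁₃⁻¹ y₂₀⁻¹ y₂₂⁻¹ : Polynomial 28
  ⟨x₂₁y₂₀⟩⁻¹ ⟨x₂₃y₂₂⟩⁻¹ : Polynomial 28
  x₋₁₂       = var (# 0)
  x₀₁        = var (# 1)
  x₀₃        = var (# 2)
  x₁₀        = var (# 3)
  x₁₂        = var (# 4)
  x₂₁        = var (# 5)
  x₂₃        = var (# 6)
  x₃₂        = var (# 7)
  y₋₁₁       = var (# 8)
  y₀₀        = var (# 9)
  y₀₂        = var (# 10)
  y₁₁        = var (# 11)
  y₁₃        = var (# 12)
  y₂₀        = var (# 13)
  y₂₂        = var (# 14)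
  y₃₁        = var (# 15)
  x₀₃⁻¹      = var (# 16)
  x₁₀⁻¹      = var (# 17)
  x₁₂⁻¹      = var (# 18)
  x₂₁⁻¹      = var (# 19)
  x₂₃⁻¹      = var (# 20)
  y₀₂⁻¹      = var (# 21)
  y₁₁⁻¹      = var (# 22)
  y₁₃⁻¹      = var (# 23)
  y₂₀⁻¹      = var (# 24)
  y₂₂⁻¹      = var (# 25)
  ⟨x₂₁y₂₀⟩⁻¹ = var (# 26)
  ⟨x₂₃y₂₂⟩⁻¹ = var (# 27)

  open PolynomialMatrices F {28}
  open LinearCombination commutativeRing ρ

  inverse-law : ∀ α j k → Even (lab α +ℤ j +ℤ k) → T α j k * T α j k ⁻¹ ≈ 1#
  inverse-law α j k e = ⁻¹-inverse (T α j k) (nonzero α j k e)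

  -- The hypotheses: the T-system relations rel-xⱼₖ (for α = 1) and rel-yⱼₖ
  -- (for α = 2) centred at (j, k), and the inverse laws.
  rel-x₀₂ rel-x₁₁ rel-x₂₂ rel-y₀₁ rel-y₁₂ rel-y₂₁ : Equation
  inv-x₀₃ inv-x₁₀ inv-x₁₂ inv-x₂₁ inv-x₂₃ inv-y₀₂ inv-y₁₁ inv-y₁₃ inv-y₂₀ inv-y₂₂ inv-x₂₁y₂₀ inv-x₂₃y₂₂ : Equation
  rel-x₀₂ = x₀₃ :* x₀₁ ≋ x₁₂ :* x₋₁₂ :+ y₀₂ by eq₁ (+ 0) (+ 2) (+ 2 , ≡.refl)
  rel-x₁₁ = x₁₂ :* x₁₀ ≋ x₂₁ :* x₀₁ :+ y₁₁ by eq₁ (+ 1) (+ 1) (+ 2 , ≡.refl)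
  rel-x₂₂ = x₂₃ :* x₂₁ ≋ x₃₂ :* x₁₂ :+ y₂₂ by eq₁ (+ 2) (+ 2) (+ 3 , ≡.refl)
  rel-y₀₁ = y₀₂ :* y₀₀ ≋ y₁₁ :* y₋₁₁ :+ x₀₁ by eq₂ (+ 0) (+ 1) (+ 2 , ≡.refl)
  rel-y₁₂ = y₁₃ :* y₁₁ ≋ y₂₂ :* y₀₂ :+ x₁₂ by eq₂ (+ 1) (+ 2) (+ 3 , ≡.refl)
  rel-y₂₁ = y₂₂ :* y₂₀ ≋ y₃₁ :* y₁₁ :+ x₂₁ by eq₂ (+ 2) (+ 1) (+ 3 , ≡.refl)
  inv-x₀₃ = x₀₃ :* x₀₃⁻¹ ≋ con (+ 1) by inverse-law α₁ (+ 0) (+ 3) (+ 2 , ≡.refl)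
  inv-x₁₀ = x₁₀ :* x₁₀⁻¹ ≋ con (+ 1) by inverse-law α₁ (+ 1) (+ 0) (+ 1 , ≡.refl)
  inv-x₁₂ = x₁₂ :* x₁₂⁻¹ ≋ con (+ 1) by inverse-law α₁ (+ 1) (+ 2) (+ 2 , ≡.refl)
  inv-x₂₁ = x₂₁ :* x₂₁⁻¹ ≋ con (+ 1) by inverse-law α₁ (+ 2) (+ 1) (+ 2 , ≡.refl)
  inv-x₂₃ = x₂₃ :* x₂₃⁻¹ ≋ con (+ 1) by inverse-law α₁ (+ 2) (+ 3) (+ 3 , ≡.refl)
  inv-y₀₂ = y₀₂ :* y₀₂⁻¹ ≋ con (+ 1) by inverse-law α₂ (+ 0) (+ 2) (+ 2 , ≡.refl)
  inv-y₁₁ = y₁₁ :* y₁₁⁻¹ ≋ con (+ 1) by inverse-law α₂ (+ 1) (+ 1) (+ 2 , ≡.refl)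
  inv-y₁₃ = y₁₃ :* y₁₃⁻¹ ≋ con (+ 1) by inverse-law α₂ (+ 1) (+ 3) (+ 3 , ≡.refl)
  inv-y₂₀ = y₂₀ :* y₂₀⁻¹ ≋ con (+ 1) by inverse-law α₂ (+ 2) (+ 0) (+ 2 , ≡.refl)
  inv-y₂₂ = y₂₂ :* y₂₂⁻¹ ≋ con (+ 1) by inverse-law α₂ (+ 2) (+ 2) (+ 3 , ≡.refl)
  inv-x₂₁y₂₀ = ⟨x₂₁y₂₀⟩⁻¹ ≋ x₂₁⁻¹ :* y₂₀⁻¹ by
      ⁻¹-*-distrib (nonzero α₁ (+ 2) (+ 1) (+ 2 , ≡.refl)) (nonzero α₂ (+ 2) (+ 0) (+ 2 , ≡.refl))
  inv-x₂₃y₂₂ = ⟨x₂₃y₂₂⟩⁻¹ ≋ x₂₃⁻¹ :* y₂₂⁻¹ by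
      ⁻¹-*-distrib (nonzero α₁ (+ 2) (+ 3) (+ 3 , ≡.refl)) (nonzero α₂ (+ 2) (+ 2) (+ 3 , ≡.refl))

  𝔅ₚ 𝔄ₚ 𝔅″ₚ 𝔄″ₚ Gₚ G₂ₚ Hₚ : PolyMat
  𝔅ₚ  = matBₚ x₀₁ x₁₀⁻¹ y₀₀ y₁₁⁻¹
  𝔄ₚ  = matAₚ x₁₀ y₁₁ x₂₁⁻¹ y₂₀⁻¹ ⟨x₂₁y₂₀⟩⁻¹
  𝔅″ₚ = matBₚ x₀₃ x₁₂⁻¹ y₀₂ y₁₃⁻¹
  𝔄″ₚ = matAₚ x₁₂ y₁₃ x₂₃⁻¹ y₂₂⁻¹ ⟨x₂₃y₂₂⟩⁻¹
  Gₚ  = gaugeₚ x₁₂ x₀₃⁻¹ y₁₁ x₋₁₂ y₀₂⁻¹ x₀₁ y₋₁₁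
  G₂ₚ = gaugeₚ x₃₂ x₂₃⁻¹ y₃₁ x₁₂ y₂₂⁻¹ x₂₁ y₁₁
  -- An intermediate gauge matrix, sitting between 𝔅₀ and 𝔄₁.
  Hₚ zero          zero          = x₂₁ :* x₁₂⁻¹
  Hₚ zero          (suc zero)    = :- ((y₂₂ :* x₁₂⁻¹) :* y₁₃⁻¹)
  Hₚ zero          (suc (suc _)) = con (+ 1) :* y₁₃⁻¹
  Hₚ (suc zero)    zero          = y₁₁ :* x₁₂⁻¹
  Hₚ (suc zero)    (suc zero)    = (x₀₁ :* x₁₂⁻¹) :* (y₂₂ :* y₁₃⁻¹)
  Hₚ (suc zero)    (suc (suc _)) = :- (x₀₁ :* y₁₃⁻¹)
  Hₚ (suc (suc _)) zero          = con (+ 0)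
  Hₚ (suc (suc _)) (suc zero)    = con (+ 1) :* y₁₃⁻¹
  Hₚ (suc (suc _)) (suc (suc _)) = y₀₂ :* y₁₃⁻¹

  -- The weights: entry (i, k) of an identity L ≈ R is the linear combination
  -- weights i k, i.e. L - R = Σ w · (l - r) over its items w ⋆ (l ≋ r).
  weights-𝔅 : Fin 3 → Fin 3 → Combination
  weights-𝔅 zero zero =
      (:- (x₁₀⁻¹ :* x₁₂⁻¹)) ⋆ rel-x₁₁
    ∷ (:- (x₁₂⁻¹ :* x₁₂)) ⋆ inv-x₀₃
    ∷ (x₁₂⁻¹ :* x₁₂) ⋆ inv-x₁₀
    ∷ []
  weights-𝔅 zero (suc zero) =
      (:- x₀₃⁻¹) ⋆ inv-x₁₂
    ∷ []
  weights-𝔅 zero (suc (suc zero)) = []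
  weights-𝔅 (suc zero) zero =
      (:- (x₁₂⁻¹ :* y₁₁)) ⋆ inv-x₀₃
    ∷ []
  weights-𝔅 (suc zero) (suc zero) =
      (x₀₃⁻¹ :* x₁₂⁻¹ :* y₀₂⁻¹ :* y₁₁) ⋆ rel-x₀₂
    ∷ (:- (x₁₂⁻¹ :* y₀₂⁻¹ :* y₁₃⁻¹ :* x₀₁)) ⋆ rel-y₁₂
    ∷ (:- (x₁₂⁻¹ :* y₀₂⁻¹ :* x₀₁ :* y₁₁)) ⋆ inv-x₀₃
    ∷ (:- (y₀₂⁻¹ :* y₁₃⁻¹ :* x₀₁) :+ x₀₃⁻¹ :* y₀₂⁻¹ :* x₋₁₂ :* y₁₁) ⋆ inv-x₁₂
    ∷ (x₀₃⁻¹ :* x₁₂⁻¹ :* y₁₁ :- x₁₂⁻¹ :* y₁₃⁻¹ :* x₀₁ :* y₂₂) ⋆ inv-y₀₂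
    ∷ (x₁₂⁻¹ :* y₀₂⁻¹ :* x₀₁ :* y₁₁) ⋆ inv-y₁₃
    ∷ []
  weights-𝔅 (suc zero) (suc (suc zero)) =
      (y₁₃⁻¹ :* x₀₁) ⋆ inv-y₀₂
    ∷ []
  weights-𝔅 (suc (suc zero)) zero =
      x₁₂⁻¹ ⋆ inv-y₁₁
    ∷ (:- x₁₂⁻¹) ⋆ inv-x₀₃
    ∷ []
  weights-𝔅 (suc (suc zero)) (suc zero) =
      (y₀₂⁻¹ :* y₁₁⁻¹ :* y₁₃⁻¹) ⋆ rel-y₀₁
    ∷ (x₀₃⁻¹ :* x₁₂⁻¹ :* y₀₂⁻¹) ⋆ rel-x₀₂
    ∷ (:- (x₁₂⁻¹ :* y₀₂⁻¹ :* y₁₁⁻¹ :* y₁₃⁻¹ :* x₀₁)) ⋆ rel-y₁₂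
    ∷ (x₀₃⁻¹ :* x₁₂⁻¹ :- y₁₁⁻¹ :* y₁₃⁻¹ :* y₀₀ :- x₁₂⁻¹ :* y₁₁⁻¹ :* y₁₃⁻¹ :* x₀₁ :* y₂₂) ⋆ inv-y₀₂
    ∷ (y₀₂⁻¹ :* y₁₃⁻¹ :* y₋₁₁ :+ x₁₂⁻¹ :* y₀₂⁻¹ :* y₁₃⁻¹ :* x₀₁ :* y₁₃) ⋆ inv-y₁₁
    ∷ (:- (x₁₂⁻¹ :* y₀₂⁻¹ :* x₀₁)) ⋆ inv-x₀₃
    ∷ (x₀₃⁻¹ :* y₀₂⁻¹ :* x₋₁₂ :- y₀₂⁻¹ :* y₁₁⁻¹ :* y₁₃⁻¹ :* x₀₁) ⋆ inv-x₁₂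
    ∷ (x₁₂⁻¹ :* y₀₂⁻¹ :* x₀₁) ⋆ inv-y₁₃
    ∷ []
  weights-𝔅 (suc (suc zero)) (suc (suc zero)) =
      (y₁₁⁻¹ :* y₁₃⁻¹) ⋆ rel-y₀₁
    ∷ (:- (y₁₃⁻¹ :* y₋₁₁)) ⋆ inv-y₀₂
    ∷ (y₁₃⁻¹ :* y₋₁₁) ⋆ inv-y₁₁
    ∷ []

  weights-𝔄 : Fin 3 → Fin 3 → Combination
  weights-𝔄 zero zero =
      (:- (x₁₂⁻¹ :* x₂₃⁻¹)) ⋆ rel-x₂₂
    ∷ (x₁₂⁻¹ :* x₂₃⁻¹ :* y₂₂) ⋆ inv-y₁₃
    ∷ (x₁₂⁻¹ :* x₂₁) ⋆ inv-x₂₃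
    ∷ (:- (x₂₃⁻¹ :* x₃₂)) ⋆ inv-x₁₂
    ∷ []
  weights-𝔄 zero (suc zero) =
      (x₁₂⁻¹ :* y₁₃⁻¹ :* x₁₂ :* y₁₃ :* y₂₂) ⋆ inv-x₂₃y₂₂
    ∷ (x₂₃⁻¹ :* y₁₃⁻¹ :* y₂₂⁻¹ :* y₁₃ :* y₂₂) ⋆ inv-x₁₂
    ∷ (x₂₃⁻¹ :* y₂₂⁻¹ :* y₂₂) ⋆ inv-y₁₃
    ∷ x₂₃⁻¹ ⋆ inv-y₂₂
    ∷ []
  weights-𝔄 zero (suc (suc zero)) =
      (y₁₃⁻¹ :* y₂₂⁻¹ :* y₂₂) ⋆ inv-x₁₂
    ∷ y₁₃⁻¹ ⋆ inv-y₂₂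
    ∷ []
  weights-𝔄 (suc zero) zero =
      (x₂₃⁻¹ :* x₁₀ :* y₁₁ :* y₃₁) ⋆ inv-x₂₁y₂₀
    ∷ (x₁₂⁻¹ :* x₂₁⁻¹ :* x₂₃⁻¹ :* y₂₂) ⋆ rel-x₁₁
    ∷ (:- (x₂₁⁻¹ :* x₂₃⁻¹ :* y₂₀⁻¹ :* x₁₀)) ⋆ rel-y₂₁
    ∷ (:- (x₁₂⁻¹ :* x₂₁⁻¹ :* x₂₃⁻¹ :* y₁₁)) ⋆ rel-x₂₂
    ∷ (:- (x₁₂⁻¹ :* x₂₃⁻¹ :* x₀₁ :* y₂₂)) ⋆ inv-y₁₃
    ∷ (:- (x₂₁⁻¹ :* x₂₃⁻¹ :* x₁₀ :* y₂₂) :- x₂₁⁻¹ :* x₂₃⁻¹ :* x₃₂ :* y₁₁) ⋆ inv-x₁₂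
    ∷ (:- (x₂₃⁻¹ :* y₂₀⁻¹ :* x₁₀) :+ x₁₂⁻¹ :* x₂₃⁻¹ :* x₀₁ :* y₂₂ :+ x₁₂⁻¹ :* x₂₃⁻¹ :* x₂₃ :* y₁₁) ⋆ inv-x₂₁
    ∷ (x₂₁⁻¹ :* x₂₃⁻¹ :* x₁₀ :* y₂₂) ⋆ inv-y₂₀
    ∷ (x₁₂⁻¹ :* y₁₁) ⋆ inv-x₂₃
    ∷ []
  weights-𝔄 (suc zero) (suc zero) =
      (x₂₃⁻¹ :* y₂₂⁻¹ :* x₁₀ :* x₁₂ :* y₁₁ :* y₃₁) ⋆ inv-x₂₁y₂₀
    ∷ (:- (x₁₂⁻¹ :* y₁₃⁻¹ :* x₀₁ :* x₁₂ :* y₁₃ :* y₂₂)) ⋆ inv-x₂₃y₂₂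
    ∷ (x₂₁⁻¹ :* x₂₃⁻¹) ⋆ rel-x₁₁
    ∷ (:- (x₂₁⁻¹ :* x₂₃⁻¹ :* y₂₀⁻¹ :* y₂₂⁻¹ :* x₁₀ :* x₁₂)) ⋆ rel-y₂₁
    ∷ (:- (x₂₃⁻¹ :* y₁₃⁻¹ :* y₂₂⁻¹ :* x₀₁ :* y₁₃ :* y₂₂)) ⋆ inv-x₁₂
    ∷ (x₂₃⁻¹ :* x₀₁ :- x₂₃⁻¹ :* y₂₀⁻¹ :* y₂₂⁻¹ :* x₁₀ :* x₁₂) ⋆ inv-x₂₁
    ∷ (x₂₁⁻¹ :* x₂₃⁻¹ :* y₂₂⁻¹ :* x₁₀ :* x₁₂ :* y₂₂) ⋆ inv-y₂₀
    ∷ (:- (x₂₃⁻¹ :* y₂₂⁻¹ :* x₀₁ :* y₂₂)) ⋆ inv-y₁₃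
    ∷ (:- (x₂₃⁻¹ :* x₀₁) :+ x₂₁⁻¹ :* x₂₃⁻¹ :* x₁₀ :* x₁₂) ⋆ inv-y₂₂
    ∷ []
  weights-𝔄 (suc zero) (suc (suc zero)) =
      (:- (y₂₂⁻¹ :* x₁₀ :* x₂₁ :* y₁₁)) ⋆ inv-x₂₁y₂₀
    ∷ (:- (y₂₀⁻¹ :* y₂₂⁻¹ :* x₁₀ :* y₁₁)) ⋆ inv-x₂₁
    ∷ (:- (y₁₃⁻¹ :* y₂₂⁻¹ :* x₀₁ :* y₂₂)) ⋆ inv-x₁₂
    ∷ (:- (y₁₃⁻¹ :* x₀₁)) ⋆ inv-y₂₂
    ∷ []
  weights-𝔄 (suc (suc zero)) zero =
      (:- x₂₃⁻¹) ⋆ inv-y₁₃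
    ∷ []
  weights-𝔄 (suc (suc zero)) (suc zero) =
      (:- (y₁₃⁻¹ :* x₁₂ :* y₁₃)) ⋆ inv-x₂₃y₂₂
    ∷ (:- (x₂₃⁻¹ :* y₂₂⁻¹ :* x₁₂)) ⋆ inv-y₁₃
    ∷ []
  weights-𝔄 (suc (suc zero)) (suc (suc zero)) =
      (y₁₃⁻¹ :* y₂₂⁻¹) ⋆ rel-y₁₂
    ∷ (:- (y₂₂⁻¹ :* y₁₁)) ⋆ inv-y₁₃
    ∷ (y₁₃⁻¹ :* y₀₂) ⋆ inv-y₂₂
    ∷ []

  weights-column : Fin 3 → Combination
  weights-column zero =
      (:- x₁₀⁻¹) ⋆ rel-x₁₁
    ∷ (x₁₀⁻¹ :* y₁₁) ⋆ inv-x₂₁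
    ∷ (:- x₁₂) ⋆ inv-x₀₃
    ∷ x₁₂ ⋆ inv-x₁₀
    ∷ []
  weights-column (suc zero) =
      y₁₁ ⋆ inv-x₂₁
    ∷ (:- y₁₁) ⋆ inv-x₀₃
    ∷ []
  weights-column (suc (suc zero)) =
      (y₁₁⁻¹ :* y₁₁) ⋆ inv-x₂₁
    ∷ (:- (con (+ 1))) ⋆ inv-x₀₃
    ∷ (con (+ 1)) ⋆ inv-y₁₁
    ∷ []

  weights-row : Fin 3 → Combination
  weights-row zero =
      (x₁₀⁻¹ :* x₂₃⁻¹ :* x₁₀ :* y₁₁ :* y₃₁) ⋆ inv-x₂₁y₂₀
    ∷ (:- (x₁₀⁻¹ :* x₂₁⁻¹ :* x₂₃⁻¹ :* x₃₂)) ⋆ rel-x₁₁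
    ∷ (:- (x₂₁⁻¹ :* x₂₃⁻¹ :* y₂₀⁻¹)) ⋆ rel-y₂₁
    ∷ (:- (x₂₁⁻¹ :* x₂₃⁻¹)) ⋆ rel-x₂₂
    ∷ (x₂₃⁻¹ :* y₂₀⁻¹ :+ x₂₁⁻¹ :* x₂₃⁻¹ :* x₁₂ :* x₃₂ :+ x₂₁⁻¹ :* x₂₃⁻¹ :* y₂₀⁻¹ :* y₁₁ :* y₃₁) ⋆ inv-x₁₀
    ∷ (:- (x₂₃⁻¹ :* y₂₀⁻¹) :+ x₂₃⁻¹ :* x₂₃ :- x₁₀⁻¹ :* x₂₃⁻¹ :* x₀₁ :* x₃₂) ⋆ inv-x₂₁
    ∷ (x₂₁⁻¹ :* x₂₃⁻¹ :* y₂₂) ⋆ inv-y₂₀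
    ∷ (con (+ 1)) ⋆ inv-x₂₃
    ∷ []
  weights-row (suc zero) =
      (x₁₀⁻¹ :* x₂₃⁻¹ :* y₂₂⁻¹ :* x₁₀ :* x₁₂ :* y₁₁ :* y₃₁) ⋆ inv-x₂₁y₂₀
    ∷ (x₁₀⁻¹ :* x₂₃⁻¹ :* y₂₀⁻¹ :* y₂₂⁻¹ :+ x₁₀⁻¹ :* x₂₁⁻¹ :* x₂₃⁻¹ :* y₂₀⁻¹ :* y₂₂⁻¹ :* y₁₁ :* y₃₁) ⋆ rel-x₁₁
    ∷ (:- (x₁₀⁻¹ :* x₂₃⁻¹ :* y₂₀⁻¹ :* y₂₂⁻¹ :* x₀₁) :- x₁₀⁻¹ :* x₂₁⁻¹ :* x₂₃⁻¹ :* y₂₀⁻¹ :* y₂₂⁻¹ :* y₁₁) ⋆ rel-y₂₁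
    ∷ (:- (x₁₀⁻¹ :* x₂₃⁻¹ :* y₂₀⁻¹ :* y₂₂⁻¹ :* y₁₁) :+ x₁₀⁻¹ :* x₂₃⁻¹ :* y₂₀⁻¹ :* y₂₂⁻¹ :* x₀₁ :* y₁₁ :* y₃₁) ⋆ inv-x₂₁
    ∷ (x₁₀⁻¹ :* x₂₃⁻¹ :* y₂₂⁻¹ :* x₀₁ :* y₂₂ :+ x₁₀⁻¹ :* x₂₁⁻¹ :* x₂₃⁻¹ :* y₂₂⁻¹ :* y₁₁ :* y₂₂) ⋆ inv-y₂₀
    ∷ (x₁₀⁻¹ :* x₂₃⁻¹ :* x₀₁ :+ x₁₀⁻¹ :* x₂₁⁻¹ :* x₂₃⁻¹ :* y₁₁) ⋆ inv-y₂₂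
    ∷ []
  weights-row (suc (suc zero)) =
      (:- (x₁₀⁻¹ :* y₂₂⁻¹ :* x₁₀ :* x₂₁ :* y₁₁)) ⋆ inv-x₂₁y₂₀
    ∷ (:- (x₁₀⁻¹ :* y₂₀⁻¹ :* y₂₂⁻¹ :* x₁₀ :* y₁₁)) ⋆ inv-x₂₁
    ∷ []
  by-combinations₃ : ∀ (L R : Fin 3 → Polynomial 28) (w : Fin 3 → Combination) →
    (∀ i → ⟦ L i :+ Σrhs (w i) ⟧↓ ρ ≈ ⟦ R i :+ Σlhs (w i) ⟧↓ ρ) → ∀ i → ⟦ L i ⟧ ρ ≈ ⟦ R i ⟧ ρ
  by-combinations₃ L R w nf i = by-combination (L i) (R i) (w i) (nf i)

  by-combinations₃ₓ₃ : ∀ (L R : PolyMat) (w : Fin 3 → Fin 3 → Combination) →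
    (∀ i k → ⟦ L i k :+ Σrhs (w i k) ⟧↓ ρ ≈ ⟦ R i k :+ Σlhs (w i k) ⟧↓ ρ) → ⟦ L ⟧ₘ ρ ≈ₘ ⟦ R ⟧ₘ ρ
  by-combinations₃ₓ₃ L R w nf i k = by-combination (L i k) (R i k) (w i k) (nf i k)

  H : Mat3
  H = ⟦ Hₚ ⟧ₘ ρ

  gauge-𝔅 : 𝔅 T (+ 0) ⊗ H ≈ₘ gauge T ⊗ 𝔅 (raise T) (+ 0)
  gauge-𝔅 = ≈ₘ-trans (⊗-cong 𝔅-eval (≈ₘ-refl {H})) (≈ₘ-trans
    (by-combinations₃ₓ₃ (𝔅ₚ ⊗ₚ Hₚ) (Gₚ ⊗ₚ 𝔅″ₚ) weights-𝔅
      (entries₃ₓ₃ refl refl refl refl refl refl refl refl refl))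
    (⊗-cong (≈ₘ-sym G-eval) (≈ₘ-sym 𝔅″-eval)))
    where
    𝔅-eval : 𝔅 T (+ 0) ≈ₘ ⟦ 𝔅ₚ ⟧ₘ ρ
    𝔅-eval = entries₃ₓ₃ refl refl refl refl refl refl refl refl refl
    G-eval : gauge T ≈ₘ ⟦ Gₚ ⟧ₘ ρ
    G-eval = entries₃ₓ₃ refl refl refl refl refl refl refl refl refl
    𝔅″-eval : 𝔅 (raise T) (+ 0) ≈ₘ ⟦ 𝔅″ₚ ⟧ₘ ρ
    𝔅″-eval = entries₃ₓ₃ refl refl refl refl refl refl refl refl refl

  gauge-𝔄 : 𝔄 T (+ 1) ⊗ gauge (translate T (+ 2)) ≈ₘ H ⊗ 𝔄 (raise T) (+ 1)
  gauge-𝔄 = ≈ₘ-trans (⊗-cong 𝔄-eval G₂-eval) (≈ₘ-trans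
    (by-combinations₃ₓ₃ (𝔄ₚ ⊗ₚ G₂ₚ) (Hₚ ⊗ₚ 𝔄″ₚ) weights-𝔄
      (entries₃ₓ₃ refl refl refl refl refl refl refl refl refl))
    (⊗-cong (≈ₘ-refl {H}) (≈ₘ-sym 𝔄″-eval)))
    where
    𝔄-eval : 𝔄 T (+ 1) ≈ₘ ⟦ 𝔄ₚ ⟧ₘ ρ
    𝔄-eval = entries₃ₓ₃ refl refl refl refl refl refl refl refl refl
    G₂-eval : gauge (translate T (+ 2)) ≈ₘ ⟦ G₂ₚ ⟧ₘ ρ
    G₂-eval = entries₃ₓ₃ refl refl refl refl refl refl refl refl refl
    𝔄″-eval : 𝔄 (raise T) (+ 1) ≈ₘ ⟦ 𝔄″ₚ ⟧ₘ ρ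
    𝔄″-eval = entries₃ₓ₃ refl refl refl refl refl refl refl refl refl

  gauge-covariance : step T ⊗ gauge (translate T (+ 2)) ≈ₘ gauge T ⊗ step (raise T)
  gauge-covariance = begin
    (𝔅₀ ⊗ 𝔄₁) ⊗ G₂       ≈⟨ ⊗-assoc 𝔅₀ 𝔄₁ G₂ ⟩
    𝔅₀ ⊗ (𝔄₁ ⊗ G₂)       ≈⟨ ⊗-cong (≈ₘ-refl {𝔅₀}) gauge-𝔄 ⟩
    𝔅₀ ⊗ (H ⊗ 𝔄″₁)       ≈⟨ ⊗-assoc 𝔅₀ H 𝔄″₁ ⟨
    (𝔅₀ ⊗ H) ⊗ 𝔄″₁       ≈⟨ ⊗-cong gauge-𝔅 (≈ₘ-refl {𝔄″₁}) ⟩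
    (G₀ ⊗ 𝔅″₀) ⊗ 𝔄″₁     ≈⟨ ⊗-assoc G₀ 𝔅″₀ 𝔄″₁ ⟩
    G₀ ⊗ (𝔅″₀ ⊗ 𝔄″₁)     ∎
    where
    open import Relation.Binary.Reasoning.Setoid matrixSetoid
    𝔅₀ = 𝔅 T (+ 0)
    𝔄₁ = 𝔄 T (+ 1)
    𝔅″₀ = 𝔅 (raise T) (+ 0)
    𝔄″₁ = 𝔄 (raise T) (+ 1)
    G₀ = gauge T
    G₂ = gauge (translate T (+ 2))

  first-column : ∀ i → step T i zero * T α₁ (+ 2) (+ 1) ≈ gauge T i zero * T α₁ (+ 0) (+ 3)
  first-column = entries₃ (column zero) (column (suc zero)) (column (suc (suc zero)))
    where
    column = by-combinations₃ (λ i → (𝔅ₚ ⊗ₚ 𝔄ₚ) i zero :* x₂₁) (λ i → Gₚ i zero :* x₀₃) weights-column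
               (entries₃ refl refl refl)

  first-row : ∀ k → (step T ⊗ gauge (translate T (+ 2))) zero k ≈ I3 zero k
  first-row = entries₃ (row zero) (row (suc zero)) (row (suc (suc zero)))
    where
    row = by-combinations₃ (((𝔅ₚ ⊗ₚ 𝔄ₚ) ⊗ₚ G₂ₚ) zero) (I3ₚ zero) weights-row (entries₃ refl refl refl)

-- All products
-- start at -1 (so that their first factor is step T); the other positions are
-- reached through translate T 2, whose products starting at -1 are those of
-- T starting at 1.
module Iteration {c ℓ : Level} (F : Field c ℓ) where
  open Field F hiding (zero)
  open FieldDefs F
  open FieldProperties F
  open Matrices F
  open Symmetries F
  open Gauge F
  open Parity
  module Local = LocalIdentities F
  module ≈-Reasoning = Relation.Binary.Reasoning.Setoid setoid
  module ≈ₘ-Reasoning = Relation.Binary.Reasoning.Setoid matrixSetoid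

  double-suc : ∀ m → nsuc m ℕ.+ nsuc m ≡ 2 ℕ.+ (m ℕ.+ m)
  double-suc m = ≡.cong nsuc (ℕP.+-suc m m)

  shifted-product : ∀ T m → prodBA T (+ 1) m ≈ₘ prodBA (translate T (+ 2)) -[1+ 0 ] m
  shifted-product T m = ≈ₘ-sym (prodBA-translate T (+ 2) -[1+ 0 ] m)

  gauge-product : ∀ T → Solution T → ∀ m →
    step T ⊗ (gauge (translate T (+ 2)) ⊗ prodBA (raise (translate T (+ 2))) -[1+ 0 ] m)
      ≈ₘ gauge T ⊗ prodBA (raise T) -[1+ 0 ] (nsuc m)
  gauge-product T sol m = begin
    step T ⊗ (gauge U ⊗ P″)                 ≈⟨ ⊗-assoc (step T) (gauge U) P″ ⟨
    (step T ⊗ gauge U) ⊗ P″                 ≈⟨ ⊗-cong (Local.gauge-covariance T sol) (≈ₘ-refl {P″}) ⟩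
    (gauge T ⊗ step (raise T)) ⊗ P″         ≈⟨ ⊗-assoc (gauge T) (step (raise T)) P″ ⟩
    gauge T ⊗ (step (raise T) ⊗ P″)         ≈⟨ ⊗-cong (≈ₘ-refl {gauge T})
                                                 (⊗-cong (≈ₘ-refl {step (raise T)}) (≈ₘ-sym (shifted-product (raise T) m))) ⟩
    gauge T ⊗ (step (raise T) ⊗ prodBA (raise T) (+ 1) m) ∎
    where
    open ≈ₘ-Reasoning
    U = translate T (+ 2)
    P″ = prodBA (raise U) -[1+ 0 ] m

  column-iteration : ∀ m T → Solution T → ∀ i →
    prodBA T -[1+ 0 ] (nsuc m) i zero * T α₁ (+ (2 ℕ.+ (m ℕ.+ m))) (+ 1)
      ≈ (gauge T ⊗ prodBA (raise T) -[1+ 0 ] m) i zero * T α₁ (+ (m ℕ.+ m)) (+ 3)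
  column-iteration nzero T sol i = begin
    (step T ⊗ I3) i zero * T α₁ (+ 2) (+ 1)    ≈⟨ *-congʳ (⊗-identityʳ (step T) i zero) ⟩
    step T i zero * T α₁ (+ 2) (+ 1)           ≈⟨ Local.first-column T sol i ⟩
    gauge T i zero * T α₁ (+ 0) (+ 3)          ≈⟨ *-congʳ (⊗-identityʳ (gauge T) i zero) ⟨
    (gauge T ⊗ I3) i zero * T α₁ (+ 0) (+ 3)   ∎
    where open ≈-Reasoning
  column-iteration (nsuc m) T sol i = begin
    (step T ⊗ prodBA T (+ 1) (nsuc m)) i zero * T α₁ (+ (2 ℕ.+ (nsuc m ℕ.+ nsuc m))) (+ 1)
      ≡⟨ ≡.cong (λ n → (step T ⊗ prodBA T (+ 1) (nsuc m)) i zero * T α₁ (+ (2 ℕ.+ n)) (+ 1)) (double-suc m) ⟩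
    (step T ⊗ prodBA T (+ 1) (nsuc m)) i zero * T α₁ (+ (4 ℕ.+ (m ℕ.+ m))) (+ 1)
      ≈⟨ *-congʳ (⊗-cong (≈ₘ-refl {step T}) (shifted-product T (nsuc m)) i zero) ⟩
    (step T ⊗ prodBA U -[1+ 0 ] (nsuc m)) i zero * T α₁ (+ (4 ℕ.+ (m ℕ.+ m))) (+ 1)
      ≈⟨ ⊗-column {X = prodBA U -[1+ 0 ] (nsuc m)} {Y = gauge U ⊗ prodBA (raise U) -[1+ 0 ] m} zero
           (column-iteration m U (translate-solution even-2 sol)) (step T) i ⟩
    (step T ⊗ (gauge U ⊗ prodBA (raise U) -[1+ 0 ] m)) i zero * T α₁ (+ (2 ℕ.+ (m ℕ.+ m))) (+ 3)
      ≈⟨ *-congʳ (gauge-product T sol m i zero) ⟩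
    (gauge T ⊗ prodBA (raise T) -[1+ 0 ] (nsuc m)) i zero * T α₁ (+ (2 ℕ.+ (m ℕ.+ m))) (+ 3)
      ≡⟨ ≡.cong (λ n → (gauge T ⊗ prodBA (raise T) -[1+ 0 ] (nsuc m)) i zero * T α₁ (+ n) (+ 3)) (double-suc m) ⟨
    (gauge T ⊗ prodBA (raise T) -[1+ 0 ] (nsuc m)) i zero * T α₁ (+ (nsuc m ℕ.+ nsuc m)) (+ 3) ∎
    where
    open ≈-Reasoning
    U = translate T (+ 2)

  corner-formula : ∀ m T → Solution T →
    T α₁ (+ m) (+ nsuc m) ≈ T α₁ (+ (m ℕ.+ m)) (+ 1) * prodBA T -[1+ 0 ] m zero zero
  corner-formula nzero T sol = sym (*-identityʳ _)
  corner-formula (nsuc nzero) T sol = begin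
    T α₁ (+ 1) (+ 2)                              ≈⟨ ÷-*-cancel (nonzero α₁ (+ 0) (+ 3) (+ 2 , ≡.refl)) ⟨
    gauge T zero zero * T α₁ (+ 0) (+ 3)          ≈⟨ Local.first-column T sol zero ⟨
    step T zero zero * T α₁ (+ 2) (+ 1)           ≈⟨ *-congʳ (⊗-identityʳ (step T) zero zero) ⟨
    (step T ⊗ I3) zero zero * T α₁ (+ 2) (+ 1)    ≈⟨ *-comm _ _ ⟩
    T α₁ (+ 2) (+ 1) * (step T ⊗ I3) zero zero    ∎
    where
    open ≈-Reasoning
    open IsA2TSystemSolution sol
  corner-formula (nsuc (nsuc m)) T sol = begin
    T α₁ (+ (2 ℕ.+ m)) (+ (3 ℕ.+ m))
      ≈⟨ corner-formula m (raise U) (raise-solution solU) ⟩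
    T α₁ (+ (2 ℕ.+ (m ℕ.+ m))) (+ 3) * P″ zero zero
      ≈⟨ *-comm _ _ ⟩
    P″ zero zero * T α₁ (+ (2 ℕ.+ (m ℕ.+ m))) (+ 3)
      ≈⟨ *-congʳ first-row-of-product ⟨
    ((step T ⊗ gauge U) ⊗ P″) zero zero * T α₁ (+ (2 ℕ.+ (m ℕ.+ m))) (+ 3)
      ≈⟨ *-congʳ (⊗-assoc (step T) (gauge U) P″ zero zero) ⟩
    (step T ⊗ (gauge U ⊗ P″)) zero zero * T α₁ (+ (2 ℕ.+ (m ℕ.+ m))) (+ 3)
      ≈⟨ ⊗-column {X = prodBA U -[1+ 0 ] (nsuc m)} {Y = gauge U ⊗ P″} zero (column-iteration m U solU) (step T) zero ⟨
    (step T ⊗ prodBA U -[1+ 0 ] (nsuc m)) zero zero * T α₁ (+ (4 ℕ.+ (m ℕ.+ m))) (+ 1)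
      ≈⟨ *-congʳ (⊗-cong (≈ₘ-refl {step T}) (shifted-product T (nsuc m)) zero zero) ⟨
    prodBA T -[1+ 0 ] (2 ℕ.+ m) zero zero * T α₁ (+ (4 ℕ.+ (m ℕ.+ m))) (+ 1)
      ≈⟨ *-comm _ _ ⟩
    T α₁ (+ (4 ℕ.+ (m ℕ.+ m))) (+ 1) * prodBA T -[1+ 0 ] (2 ℕ.+ m) zero zero
      ≡⟨ ≡.cong (λ n → T α₁ (+ n) (+ 1) * prodBA T -[1+ 0 ] (2 ℕ.+ m) zero zero) double-suc² ⟨
    T α₁ (+ (nsuc (nsuc m) ℕ.+ nsuc (nsuc m))) (+ 1) * prodBA T -[1+ 0 ] (2 ℕ.+ m) zero zero ∎
    where
    open ≈-Reasoning
    U = translate T (+ 2)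
    solU = translate-solution even-2 sol
    P″ = prodBA (raise U) -[1+ 0 ] m
    double-suc² : nsuc (nsuc m) ℕ.+ nsuc (nsuc m) ≡ 4 ℕ.+ (m ℕ.+ m)
    double-suc² = ≡.trans (double-suc (nsuc m)) (≡.cong (2 ℕ.+_) (double-suc m))
    first-row-of-product : ((step T ⊗ gauge U) ⊗ P″) zero zero ≈ P″ zero zero
    first-row-of-product = trans (⊗-row {A = step T ⊗ gauge U} {B = I3} zero (Local.first-row T sol) P″ zero)
                                 (⊗-identityˡ P″ zero zero)

-- Translating by the even integer p = j - m moves the product to start at
-- -1, where corner-formula applies.
mainTheorem2 : {c ℓ : Level} (F : Field c ℓ) (T : Fin 2 → ℤ → ℤ → Field.Carrier F) →
    FieldDefs.IsA2TSystemSolution F T →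
    (j : ℤ) (m : ℕ) → Even (+ 1 +ℤ j +ℤ + (nsuc m)) →
    Field._≈_ F (T zero j (+ (nsuc m)))
    (Field._*_ F (T zero (j +ℤ + (nsuc m) -ℤ + 1) (+ 1))
    (FieldDefs.prodBA F T (j -ℤ + (nsuc m)) m zero zero))
mainTheorem2 F T sol j m ev = begin
  T α₁ j (+ nsuc m)                                       ≡⟨ ≡.cong (λ i → T α₁ i (+ nsuc m)) (back-to-j j (+ m)) ⟨
  U α₁ (+ m) (+ nsuc m)                                   ≈⟨ corner-formula m U (translate-solution even-p sol) ⟩
  U α₁ (+ (m ℕ.+ m)) (+ 1) * prodBA U -[1+ 0 ] m zero zero
    ≈⟨ *-cong (reflexive (≡.cong (λ i → T α₁ i (+ 1)) (last-column j (+ m))))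
              (prodBA-translate T p -[1+ 0 ] m zero zero) ⟩
  T α₁ (j +ℤ + nsuc m -ℤ + 1) (+ 1) * prodBA T (p +ℤ -[1+ 0 ]) m zero zero
    ≡⟨ ≡.cong (λ s → T α₁ (j +ℤ + nsuc m -ℤ + 1) (+ 1) * prodBA T s m zero zero) (first-step j (+ m)) ⟩
  T α₁ (j +ℤ + nsuc m -ℤ + 1) (+ 1) * prodBA T (j -ℤ + nsuc m) m zero zero ∎
  where
  open Field F hiding (zero)
  open FieldDefs F
  open Symmetries F
  open Iteration F using (corner-formula)
  open Parity
  open import Relation.Binary.Reasoning.Setoid setoid
  open import Data.Integer.Tactic.RingSolver using (solve-∀)
  p = j -ℤ + m
  U = translate T p
  back-to-j : ∀ j m → (j -ℤ m) +ℤ m ≡ j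
  back-to-j = solve-∀
  last-column : ∀ j m → (j -ℤ m) +ℤ (m +ℤ m) ≡ j +ℤ (+ 1 +ℤ m) -ℤ + 1
  last-column = solve-∀
  first-step : ∀ j m → (j -ℤ m) +ℤ -[1+ 0 ] ≡ j -ℤ (+ 1 +ℤ m)
  first-step = solve-∀
  parity : ∀ j m → + 1 +ℤ j +ℤ (+ 1 +ℤ m) ≡ (j -ℤ m) +ℤ ((+ 1 +ℤ m) +ℤ (+ 1 +ℤ m))
  parity = solve-∀
  even-p : Even p
  even-p = even-cancel (+ 1 +ℤ + m) (≡.subst Even (parity j (+ m)) ev)
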